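{- Let $H=(V,E,\{r_e\})$ be a hypergraph with maximum hyperedge size $k$, where each $r_e\colon\{0,\dots,|e|\}\to\mathbb{R}_{\ge 0}$ is monotone nondecreasing with $r_e(0)=0$. For each $e\in E$ let $s_e$ be a function satisfying $0 \leq s_e(i) \leq r_e(i)$ and $r_e(i) - s_e(i-1) \leq r_e(i+1) - s_e(i)$ (for all $i$ where these quantities are defined). Then the peeling algorithm below, run with these $s_e$, returns a set $Y$ with $\Gamma(Y) \geq \frac{1}{k}\max_{\emptyset\ne S\subseteq V}\Gamma(S)$. Peeling algorithm: set $X\leftarrow V$ and $Y\leftarrow V$. While $X\neq\emptyset$: choose $v\in\arg\min_{u\in X}\sum_{e\in E:\, u\in e}\big(r_e(|e\cap X|)-s_e(|e\cap X|-1)\big)$; set $X\leftarrow X\setminus\{v\}$; if $\Gamma(X)\ge\Gamma(Y)$, set $Y\leftarrow X$. Output $Y$.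
   Context: For a nonempty $S\subseteq V$, $f(S)=\sum_{e\in E} r_e(|e\cap S|)$ and $\Gamma(S)=f(S)/|S|$ (all edge weights are $1$; weights can be absorbed into the rewards). The problem (\textsc{swamp}) is to find a nonempty $S\subseteq V$ maximizing $\Gamma(S)$.
   Formalization: The rewards $r_e$ and the functions $s_e$ take rational values rather than real values. -}

module Defs where

open import Data.Nat as ℕ using (ℕ; zero; suc; _∸_; _⊔_; _<_)
open import Data.Fin using (Fin; zero; suc)
open import Data.Fin.Subset using (Subset; _∈_; _∩_; ∣_∣; Nonempty; Empty) renaming (_-_ to _∖_)
open import Data.Integer using (+_)
open import Data.Rational using (ℚ; 0ℚ; _+_; _-_; _*_; _/_; _≤_)
open import Data.Sum using (_⊎_)
open import Relation.Nullary using (¬_)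
open import Relation.Binary.PropositionalEquality using (_≡_)
open import Data.Product using (_×_)
open import Data.Bool using (true; false)
open import Data.Vec using (lookup)

Σℚ : ∀ {m} → (Fin m → ℚ) → ℚ
Σℚ {zero}  f = 0ℚ
Σℚ {suc m} f = f zero + Σℚ (λ i → f (suc i))

maxℕ : ∀ {m} → (Fin m → ℕ) → ℕ
maxℕ {zero}  f = 0
maxℕ {suc m} f = f zero ⊔ maxℕ (λ i → f (suc i))

-- A hypergraph on vertex set V = Fin n with m hyperedges E e (e : Fin m),
-- each with a reward function r e : {0..|E e|} → ℚ≥0 (values outside the
-- domain are irrelevant).
module Hypergraph {n m : ℕ} (E : Fin m → Subset n) (r : Fin m → ℕ → ℚ) where

  maxEdgeSize : ℕ
  maxEdgeSize = maxℕ (λ e → ∣ E e ∣)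

  f : Subset n → ℚ
  f S = Σℚ (λ e → r e ∣ E e ∩ S ∣)

  -- Γ(S) = f(S)/|S|  (for S nonempty, suc (|S| ∸ 1) = |S|; for S = ∅ this
  -- gives f(∅)/1, a value never used for the empty set)
  Γ : Subset n → ℚ
  Γ S = f S * ((+ 1) / suc (∣ S ∣ ∸ 1))

  record ValidReward (e : Fin m) : Set where
    field
      r-zero : r e 0 ≡ 0ℚ
      r-nonneg : ∀ i → i ℕ.≤ ∣ E e ∣ → 0ℚ ≤ r e i
      r-mono : ∀ i → suc i ℕ.≤ ∣ E e ∣ → r e i ≤ r e (suc i)

  record ValidS (s : Fin m → ℕ → ℚ) (e : Fin m) : Set where
    field
      s-nonneg : ∀ i → i ℕ.≤ ∣ E e ∣ → 0ℚ ≤ s e i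
      s-le-r : ∀ i → i ℕ.≤ ∣ E e ∣ → s e i ≤ r e i
      s-inc : ∀ j → suc (suc j) ℕ.≤ ∣ E e ∣ →
              r e (suc j) - s e j ≤ r e (suc (suc j)) - s e (suc j)

  module Peeling (s : Fin m → ℕ → ℚ) where

    weight : Subset n → Fin n → ℚ
    weight X u = Σℚ (λ e → term e)
      where
        term : Fin m → ℚ
        term e with lookup (E e) u
        ... | true  = r e ∣ E e ∩ X ∣ - s e (∣ E e ∩ X ∣ ∸ 1)
        ... | false = 0ℚ

    IsArgmin : Subset n → Fin n → Set
    IsArgmin X v = v ∈ X × (∀ u → u ∈ X → weight X v ≤ weight X u)

    -- Run X Y Out : starting the while-loop in state (X, Y), some execution
    -- of the algorithm (with any tie-breaking in the argmin) outputs Out.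
    data Run : Subset n → Subset n → Subset n → Set where
      done   : ∀ {X Y} → Empty X → Run X Y Y
      update : ∀ {X Y Out} v → IsArgmin X v →
               Nonempty (X ∖ v) → Γ Y ≤ Γ (X ∖ v) →
               Run (X ∖ v) (X ∖ v) Out → Run X Y Out
      keep   : ∀ {X Y Out} v → IsArgmin X v →
               (Empty (X ∖ v) ⊎ ¬ (Γ Y ≤ Γ (X ∖ v))) →
               Run (X ∖ v) Y Out → Run X Y Out

{-# OPTIONS --safe #-}

-- Call T removal-stable if deleting any one vertex does not raise its density. A nonempty S
-- reaches such a T with Γ S ≤ Γ T by repeatedly deleting a vertex whose removal raises the
-- density. Let v be the first vertex of T peeled by the algorithm, from the current set X ⊇ T.
-- Stability gives Γ T ≤ f T − f (T ∖ v), and since s ≤ r and i ↦ r(i+1) − s(i) is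
-- nondecreasing, this marginal loss is at most the peeling weight of v in X, hence at most the
-- weight of every u ∈ X. Summing over X counts each edge e at most |e ∩ X| ≤ k times with a
-- term at most r_e(|e ∩ X|), so |X| Γ T ≤ k f X, i.e. Γ T ≤ k Γ X ≤ k Γ Y.

module Submission where

open import Defs
open import Data.Nat using (ℕ)
open import Data.Fin using (Fin)
open import Data.Fin.Subset using (Subset; ⊤; Nonempty)
open import Data.Integer using (+_)
open import Data.Rational using (ℚ; _*_; _/_; _≤_)

open import Algebra.Bundles using (CommutativeRing)
open import Data.Bool using (Bool; true; false; _∧_)
open import Data.Empty using (⊥-elim)
open import Data.Fin using (zero; suc)
open import Data.Fin.Properties using (any?)
open import Data.Fin.Subset
  using (_∈_; _∉_; _⊆_; _∩_; _─_; ∣_∣; Empty; ⊥; ⁅_⁆; inside; outside)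
  renaming (_-_ to _∖_)
open import Data.Fin.Subset.Properties
  using (_∈?_; nonempty?; Empty-unique; ∣⊥∣≡0; ∩-zeroʳ; p─⊥≡p; p─q⊆p; ⊆⊤;
         x∈p∧x≢y⇒x∈p-y; x∈p⇒∣p-x∣<∣p∣; x∈p∩q⁺; x∈p∩q⁻; ⊆-antisym;
         p⊆q⇒∣p∣≤∣q∣; ∣p∩q∣≤∣p∣)
import Data.Integer as ℤ
import Data.Integer.Properties as ℤ
import Data.Nat as ℕ
open import Data.Nat using (zero; suc; _∸_; z≤n; s≤s)
open import Data.Nat.Induction using (<-wellFounded)
import Data.Nat.Properties as ℕ
open import Data.Product using (_×_; _,_; proj₁; ∃-syntax)
open import Data.Rational
  using (0ℚ; 1ℚ; _+_; _-_; -_; _<_; toℚᵘ; NonNegative; nonNegative)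
open import Data.Rational.Properties
open import Data.Rational.Solver using (module +-*-Solver)
import Data.Rational.Unnormalised as ℚᵘ
import Data.Rational.Unnormalised.Properties as ℚᵘ
open import Data.Sum using (_⊎_; inj₁; inj₂)
open import Data.Vec using (_∷_; []; lookup; here; there)
open import Data.Vec.Properties using (lookup⇒[]=; []=⇒lookup; lookup-zipWith)
open import Function using (_∘_; case_of_)
open import Induction.WellFounded using (module All)
open import Level using (0ℓ)
import Relation.Binary.Construct.On as On
open import Relation.Binary.PropositionalEquality
open import Relation.Nullary using (yes; no; ¬_)
open import Relation.Nullary.Decidable using (_×-dec_)

open import Algebra.Properties.Semiring.Sum (CommutativeRing.semiring +-*-commutativeRing)
  using (sum; sum-syntax; sum-cong-≗; sum-replicate-zero; ∑-distrib-+; ∑-comm;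
         *-distribˡ-sum; *-distribʳ-sum)
open +-*-Solver using (solve; con; _:+_; _:-_; _:*_; _:=_)

fromℕ : ℕ → ℚ
fromℕ a = + a / 1

fromℕ-nonNeg : ∀ a → NonNegative (fromℕ a)
fromℕ-nonNeg a = normalize-nonNeg a 1

fromℕ-+ : ∀ a b → fromℕ (a ℕ.+ b) ≡ fromℕ a + fromℕ b
fromℕ-+ a b = toℚᵘ-injective (begin
  toℚᵘ (fromℕ (a ℕ.+ b))                ≈⟨ toℚᵘ-fromℚᵘ (⟦ a ℕ.+ b ⟧) ⟩
  ⟦ a ℕ.+ b ⟧                           ≈⟨ ℚᵘ.*≡* ↥≡ ⟩
  ⟦ a ⟧ ℚᵘ.+ ⟦ b ⟧                      ≈⟨ ℚᵘ.+-cong (ℚᵘ.≃-sym (toℚᵘ-fromℚᵘ ⟦ a ⟧))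
                                                    (ℚᵘ.≃-sym (toℚᵘ-fromℚᵘ ⟦ b ⟧)) ⟩
  toℚᵘ (fromℕ a) ℚᵘ.+ toℚᵘ (fromℕ b)    ≈⟨ ℚᵘ.≃-sym (toℚᵘ-homo-+ (fromℕ a) (fromℕ b)) ⟩
  toℚᵘ (fromℕ a + fromℕ b)              ∎)
  where
  open ℚᵘ.≃-Reasoning
  ⟦_⟧ : ℕ → ℚᵘ.ℚᵘ
  ⟦ c ⟧ = ℚᵘ.mkℚᵘ (+ c) 0
  ↥≡ : + (a ℕ.+ b) ℤ.* ℤ.1ℤ ≡ (+ a ℤ.* ℤ.1ℤ ℤ.+ + b ℤ.* ℤ.1ℤ) ℤ.* ℤ.1ℤ
  ↥≡ = trans (ℤ.*-identityʳ _)
             (sym (trans (ℤ.*-identityʳ _) (cong₂ ℤ._+_ (ℤ.*-identityʳ (+ a)) (ℤ.*-identityʳ (+ b)))))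

fromℕ-suc : ∀ a → fromℕ (suc a) ≡ 1ℚ + fromℕ a
fromℕ-suc = fromℕ-+ 1

fromℕ-mono-≤ : ∀ {a b} → a ℕ.≤ b → fromℕ a ≤ fromℕ b
fromℕ-mono-≤ {a} {b} a≤b = begin
  fromℕ a                  ≡⟨ sym (+-identityʳ (fromℕ a)) ⟩
  fromℕ a + 0ℚ             ≤⟨ +-monoʳ-≤ (fromℕ a) (nonNegative⁻¹ (fromℕ (b ∸ a)) {{fromℕ-nonNeg (b ∸ a)}}) ⟩
  fromℕ a + fromℕ (b ∸ a)  ≡⟨ sym (fromℕ-+ a (b ∸ a)) ⟩
  fromℕ (a ℕ.+ (b ∸ a))    ≡⟨ cong fromℕ (ℕ.m+[n∸m]≡n a≤b) ⟩
  fromℕ b                  ∎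
  where open ≤-Reasoning

fromℕ-*-inverseʳ : ∀ d → fromℕ (suc d) * (+ 1 / suc d) ≡ 1ℚ
fromℕ-*-inverseʳ d = toℚᵘ-injective (begin
  toℚᵘ (fromℕ (suc d) * (+ 1 / suc d))           ≈⟨ toℚᵘ-homo-* (fromℕ (suc d)) (+ 1 / suc d) ⟩
  toℚᵘ (fromℕ (suc d)) ℚᵘ.* toℚᵘ (+ 1 / suc d)  ≈⟨ ℚᵘ.*-cong (toℚᵘ-fromℚᵘ (ℚᵘ.mkℚᵘ (+ suc d) 0))
                                                             (toℚᵘ-fromℚᵘ (ℚᵘ.mkℚᵘ (+ 1) d)) ⟩
  ℚᵘ.mkℚᵘ (+ suc d) 0 ℚᵘ.* ℚᵘ.mkℚᵘ (+ 1) d       ≈⟨ ℚᵘ.*-inverseʳ (ℚᵘ.mkℚᵘ (+ suc d) 0) ⟩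
  toℚᵘ 1ℚ                                       ∎)
  where open ℚᵘ.≃-Reasoning

fromℕ-cancelˡ-≤ : ∀ c {p q} → 0 ℕ.< c → fromℕ c * p ≤ fromℕ c * q → p ≤ q
fromℕ-cancelˡ-≤ (suc c) _ = *-cancelˡ-≤-pos (fromℕ (suc c)) {{normalize-pos (suc c) 1}}

-- Γ divides by suc (c ∸ 1) rather than c, which agrees with c exactly when c > 0.
q≡c*[q/c] : ∀ q {c d} → c ≡ suc d → q ≡ fromℕ c * (q * (+ 1 / suc (c ∸ 1)))
q≡c*[q/c] q {d = d} refl = begin
  q                                        ≡⟨ sym (*-identityʳ q) ⟩
  q * 1ℚ                                   ≡⟨ cong (q *_) (sym (fromℕ-*-inverseʳ d)) ⟩
  q * (fromℕ (suc d) * (+ 1 / suc d))      ≡⟨ solve 3 (λ q c i → q :* (c :* i) := c :* (q :* i))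
                                                      refl q (fromℕ (suc d)) (+ 1 / suc d) ⟩
  fromℕ (suc d) * (q * (+ 1 / suc d))      ∎
  where open ≡-Reasoning

p-q≤p : ∀ {p q} → 0ℚ ≤ q → p - q ≤ p
p-q≤p {p} {q} 0≤q = begin
  p - q    ≤⟨ +-monoʳ-≤ p (neg-antimono-≤ 0≤q) ⟩
  p + 0ℚ   ≡⟨ +-identityʳ p ⟩
  p        ∎
  where open ≤-Reasoning

sum-mono-≤ : ∀ {k} {g h : Fin k → ℚ} → (∀ i → g i ≤ h i) → sum g ≤ sum h
sum-mono-≤ {zero}  g≤h = ≤-refl
sum-mono-≤ {suc k} g≤h = +-mono-≤ (g≤h zero) (sum-mono-≤ (g≤h ∘ suc))

Σℚ≗sum : ∀ {k} {g h : Fin k → ℚ} → (∀ i → g i ≡ h i) → Σℚ g ≡ sum h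
Σℚ≗sum {zero}  g≗h = refl
Σℚ≗sum {suc k} g≗h = cong₂ _+_ (g≗h zero) (Σℚ≗sum (g≗h ∘ suc))

maxℕ-upper : ∀ {k} (g : Fin k → ℕ) i → g i ℕ.≤ maxℕ g
maxℕ-upper g zero    = ℕ.m≤m⊔n (g zero) _
maxℕ-upper g (suc i) = ℕ.≤-trans (maxℕ-upper (g ∘ suc) i) (ℕ.m≤n⊔m (g zero) _)

𝟙 : Bool → ℚ
𝟙 true  = 1ℚ
𝟙 false = 0ℚ

𝟙-∧ : ∀ a b → 𝟙 (a ∧ b) ≡ 𝟙 a * 𝟙 b
𝟙-∧ true  b = sym (*-identityˡ (𝟙 b))
𝟙-∧ false b = sym (*-zeroˡ (𝟙 b))

𝟙-∩ : ∀ {n} (p q : Subset n) u → 𝟙 (lookup (p ∩ q) u) ≡ 𝟙 (lookup p u) * 𝟙 (lookup q u)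
𝟙-∩ p q u = trans (cong 𝟙 (lookup-zipWith _∧_ u p q)) (𝟙-∧ (lookup p u) (lookup q u))

∑𝟙≡∣p∣ : ∀ {n} (p : Subset n) → ∑[ u < n ] 𝟙 (lookup p u) ≡ fromℕ ∣ p ∣
∑𝟙≡∣p∣ []          = refl
∑𝟙≡∣p∣ (true  ∷ p) = trans (cong (_+_ 1ℚ) (∑𝟙≡∣p∣ p)) (sym (fromℕ-suc ∣ p ∣))
∑𝟙≡∣p∣ (false ∷ p) = trans (+-identityˡ _) (∑𝟙≡∣p∣ p)

∑𝟙*c≡∣p∣*c : ∀ {n} (p : Subset n) c → ∑[ u < n ] (𝟙 (lookup p u) * c) ≡ fromℕ ∣ p ∣ * c
∑𝟙*c≡∣p∣*c p c = trans (sym (*-distribʳ-sum c (𝟙 ∘ lookup p))) (cong (_* c) (∑𝟙≡∣p∣ p))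

𝟙-*-mono-≤ : ∀ {n} {p : Subset n} {u a b} → (u ∈ p → a ≤ b) → 𝟙 (lookup p u) * a ≤ 𝟙 (lookup p u) * b
𝟙-*-mono-≤ {p = p} {u} {a} {b} a≤b with lookup p u in u∈?p
... | true  = *-monoˡ-≤-nonNeg 1ℚ (a≤b (lookup⇒[]= u p u∈?p))
... | false = ≤-reflexive (trans (*-zeroˡ a) (sym (*-zeroˡ b)))

∣p∣≡1+∣p∖x∣ : ∀ {n} {p : Subset n} {x} → x ∈ p → ∣ p ∣ ≡ suc ∣ p ∖ x ∣
∣p∣≡1+∣p∖x∣ {p = inside  ∷ p} here        = cong (suc ∘ ∣_∣) (sym (p─⊥≡p p))
∣p∣≡1+∣p∖x∣ {p = inside  ∷ p} (there x∈p) = cong suc (∣p∣≡1+∣p∖x∣ x∈p)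
∣p∣≡1+∣p∖x∣ {p = outside ∷ p} (there x∈p) = ∣p∣≡1+∣p∖x∣ x∈p

x∉p⇒p∖x≡p : ∀ {n} {p : Subset n} {x} → x ∉ p → p ∖ x ≡ p
x∉p⇒p∖x≡p {p = p} {x} x∉p = ⊆-antisym (p─q⊆p p ⁅ x ⁆) (λ y∈p → x∈p∧x≢y⇒x∈p-y y∈p (λ { refl → x∉p y∈p }))

∩-─-assoc : ∀ {n} (p q r : Subset n) → p ∩ (q ─ r) ≡ (p ∩ q) ─ r
∩-─-assoc []          []      []            = refl
∩-─-assoc (a     ∷ p) (b ∷ q) (outside ∷ r) = cong (a ∧ b ∷_) (∩-─-assoc p q r)
∩-─-assoc (true  ∷ p) (b ∷ q) (inside  ∷ r) = cong (outside ∷_) (∩-─-assoc p q r)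
∩-─-assoc (false ∷ p) (b ∷ q) (inside  ∷ r) = cong (outside ∷_) (∩-─-assoc p q r)

∣p∩q∣≡1+∣p∩[q∖x]∣ : ∀ {n} {p q : Subset n} {x} → x ∈ p → x ∈ q → ∣ p ∩ q ∣ ≡ suc ∣ p ∩ (q ∖ x) ∣
∣p∩q∣≡1+∣p∩[q∖x]∣ {p = p} {q} {x} x∈p x∈q =
  trans (∣p∣≡1+∣p∖x∣ (x∈p∩q⁺ (x∈p , x∈q))) (cong (suc ∘ ∣_∣) (sym (∩-─-assoc p q ⁅ x ⁆)))

x∉p⇒∣p∩[q∖x]∣≡∣p∩q∣ : ∀ {n} {p q : Subset n} {x} → x ∉ p → ∣ p ∩ (q ∖ x) ∣ ≡ ∣ p ∩ q ∣
x∉p⇒∣p∩[q∖x]∣≡∣p∩q∣ {p = p} {q} {x} x∉p =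
  cong ∣_∣ (trans (∩-─-assoc p q ⁅ x ⁆) (x∉p⇒p∖x≡p (x∉p ∘ proj₁ ∘ x∈p∩q⁻ p q)))

lookup≡false⇒∉ : ∀ {n} {p : Subset n} {x} → lookup p x ≡ false → x ∉ p
lookup≡false⇒∉ p[x]≡false x∈p with () ← trans (sym p[x]≡false) ([]=⇒lookup x∈p)

∩-monoʳ-⊆ : ∀ {n} (p : Subset n) {q r} → q ⊆ r → p ∩ q ⊆ p ∩ r
∩-monoʳ-⊆ p {q} q⊆r x∈p∩q with x∈p∩q⁻ p q x∈p∩q
... | x∈p , x∈q = x∈p∩q⁺ (x∈p , q⊆r x∈q)

⊆-∖ : ∀ {n} {p q : Subset n} {x} → p ⊆ q → x ∉ p → p ⊆ q ∖ x
⊆-∖ p⊆q x∉p y∈p = x∈p∧x≢y⇒x∈p-y (p⊆q y∈p) (λ { refl → x∉p y∈p })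

module _ {n m : ℕ} (E : Fin m → Subset n) (r : Fin m → ℕ → ℚ) where
  open Hypergraph E r

  f≡sum : ∀ S → f S ≡ ∑[ e < m ] r e ∣ E e ∩ S ∣
  f≡sum S = Σℚ≗sum {h = λ e → r e ∣ E e ∩ S ∣} (λ _ → refl)

  f≡∣S∣*Γ : ∀ {S} → Nonempty S → f S ≡ fromℕ ∣ S ∣ * Γ S
  f≡∣S∣*Γ {S} (x , x∈S) = q≡c*[q/c] (f S) (∣p∣≡1+∣p∖x∣ x∈S)

  -- Deleting a vertex never raises the density; phrased through f so that it stays
  -- meaningful when T ∖ v is empty, where Γ is a junk value.
  RemovalStable : Subset n → Set
  RemovalStable T = ∀ v → v ∈ T → f (T ∖ v) ≤ fromℕ ∣ T ∖ v ∣ * Γ T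

  removalStable-or-improvable :
    ∀ S → RemovalStable S ⊎ ∃[ v ] v ∈ S × fromℕ ∣ S ∖ v ∣ * Γ S < f (S ∖ v)
  removalStable-or-improvable S with any? (λ v → v ∈? S ×-dec (fromℕ ∣ S ∖ v ∣ * Γ S <? f (S ∖ v)))
  ... | yes improvable = inj₂ improvable
  ... | no ¬improvable = inj₁ (λ v v∈S → ≮⇒≥ (λ gain → ¬improvable (v , v∈S , gain)))

  module _ (r-zero : ∀ e → r e 0 ≡ 0ℚ) where

    f⊥≡0 : f ⊥ ≡ 0ℚ
    f⊥≡0 = begin
      f ⊥                         ≡⟨ f≡sum ⊥ ⟩
      ∑[ e < m ] r e ∣ E e ∩ ⊥ ∣  ≡⟨ sum-cong-≗ r⊥≡0 ⟩
      ∑[ e < m ] 0ℚ               ≡⟨ sum-replicate-zero m ⟩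
      0ℚ                          ∎
      where
      open ≡-Reasoning
      r⊥≡0 : ∀ e → r e ∣ E e ∩ ⊥ ∣ ≡ 0ℚ
      r⊥≡0 e = trans (cong (r e ∘ ∣_∣) (∩-zeroʳ (E e))) (trans (cong (r e) (∣⊥∣≡0 n)) (r-zero e))

    ∣T∣*c<f⇒c<Γ : ∀ {T c} → fromℕ ∣ T ∣ * c < f T → Nonempty T × c < Γ T
    ∣T∣*c<f⇒c<Γ {T} {c} ∣T∣*c<fT with nonempty? T
    ... | yes T≠∅ = T≠∅ , *-cancelˡ-<-nonNeg (fromℕ ∣ T ∣) {{fromℕ-nonNeg ∣ T ∣}}
                                               (subst (_ <_) (f≡∣S∣*Γ T≠∅) ∣T∣*c<fT)
    ... | no  T=∅ with refl ← Empty-unique T=∅ =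
      ⊥-elim (<-irrefl refl (subst₂ _<_ ∣⊥∣*c≡0 f⊥≡0 ∣T∣*c<fT))
      where
      ∣⊥∣*c≡0 : fromℕ ∣ ⊥ {n = n} ∣ * c ≡ 0ℚ
      ∣⊥∣*c≡0 = trans (cong (λ a → fromℕ a * c) (∣⊥∣≡0 n)) (*-zeroˡ c)

    denser-removalStable : ∀ S → Nonempty S → ∃[ T ] Nonempty T × RemovalStable T × Γ S ≤ Γ T
    denser-removalStable = All.wfRec (On.wellFounded ∣_∣ <-wellFounded) 0ℓ Claim step
      where
      Claim : Subset n → Set
      Claim S = Nonempty S → ∃[ T ] Nonempty T × RemovalStable T × Γ S ≤ Γ T

      climb : ∀ {S S′} → Γ S < Γ S′ → ∃[ T ] Nonempty T × RemovalStable T × Γ S′ ≤ Γ T →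
              ∃[ T ] Nonempty T × RemovalStable T × Γ S ≤ Γ T
      climb ΓS<ΓS′ (T , T≠∅ , T-stable , ΓS′≤ΓT) = T , T≠∅ , T-stable , ≤-trans (<⇒≤ ΓS<ΓS′) ΓS′≤ΓT

      step : ∀ S → (∀ {S′} → ∣ S′ ∣ ℕ.< ∣ S ∣ → Claim S′) → Claim S
      step S smaller S≠∅ = case removalStable-or-improvable S of λ where
        (inj₁ stable)           → S , S≠∅ , stable , ≤-refl
        (inj₂ (v , v∈S , gain)) →
          let S∖v≠∅ , ΓS<ΓS∖v = ∣T∣*c<f⇒c<Γ {S ∖ v} {Γ S} gain
          in climb ΓS<ΓS∖v (smaller {S ∖ v} (x∈p⇒∣p-x∣<∣p∣ v∈S) S∖v≠∅)

  module _ (s : Fin m → ℕ → ℚ) where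
    open Peeling s

    peelCost : Fin m → ℕ → ℚ
    peelCost e i = r e i - s e (i ∸ 1)

    -- The summand of weight is local to its where-block, so it enters here only as a
    -- metavariable, solved by the use in weight≡sum below.
    weight-summand≡ : ∀ X u e → _ ≡ 𝟙 (lookup (E e) u) * peelCost e ∣ E e ∩ X ∣

    weight≡sum : ∀ X u → weight X u ≡ ∑[ e < m ] (𝟙 (lookup (E e) u) * peelCost e ∣ E e ∩ X ∣)
    weight≡sum X u = Σℚ≗sum (weight-summand≡ X u)

    weight-summand≡ X u e with lookup (E e) u
    ... | true  = sym (*-identityˡ (peelCost e ∣ E e ∩ X ∣))
    ... | false = sym (*-zeroˡ (peelCost e ∣ E e ∩ X ∣))

    Run⇒Γ≤output : ∀ {X Y Out} → Run X Y Out → Γ Y ≤ Γ Out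
    Run⇒Γ≤output (done _)                 = ≤-refl
    Run⇒Γ≤output (update _ _ _ Y≤X∖v run) = ≤-trans Y≤X∖v (Run⇒Γ≤output run)
    Run⇒Γ≤output (keep _ _ _ run)         = Run⇒Γ≤output run

    kept-Γ≤ : ∀ {X Y v} → Empty (X ∖ v) ⊎ ¬ (Γ Y ≤ Γ (X ∖ v)) → Nonempty (X ∖ v) → Γ (X ∖ v) ≤ Γ Y
    kept-Γ≤ (inj₁ X∖v=∅) X∖v≠∅ = ⊥-elim (X∖v=∅ X∖v≠∅)
    kept-Γ≤ (inj₂ Y≰X∖v) _     = <⇒≤ (≰⇒> Y≰X∖v)

    module _ (valid-r : ∀ e → ValidReward e) (valid-s : ∀ e → ValidS s e) where
      open ValidReward
      open ValidS

      k : ℕ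
      k = maxEdgeSize

      peelCost-mono : ∀ e {i j} → i ℕ.< j → j ℕ.≤ ∣ E e ∣ → peelCost e (suc i) ≤ peelCost e j
      peelCost-mono e {i} {suc j} (s≤s i≤j) 1+j≤∣e∣ with ℕ.m≤n⇒m<n∨m≡n i≤j
      ... | inj₂ refl          = ≤-refl
      ... | inj₁ i<j@(s≤s _)   =
        ≤-trans (peelCost-mono e i<j (ℕ.<⇒≤ 1+j≤∣e∣)) (s-inc (valid-s e) _ 1+j≤∣e∣)

      r[e∩T]≤r[e∩T∖v]+cost : ∀ {T X v} → T ⊆ X → v ∈ T → ∀ e →
        r e ∣ E e ∩ T ∣ ≤ r e ∣ E e ∩ (T ∖ v) ∣ + (𝟙 (lookup (E e) v) * peelCost e ∣ E e ∩ X ∣)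
      r[e∩T]≤r[e∩T∖v]+cost {T} {X} {v} T⊆X v∈T e with lookup (E e) v in v∈?e
      ... | true = begin
        r e ∣ E e ∩ T ∣              ≡⟨ cong (r e) ∣e∩T∣≡1+i ⟩
        r e (suc i)                  ≡⟨ solve 2 (λ a b → a := b :+ (a :- b)) refl (r e (suc i)) (s e i) ⟩
        s e i + peelCost e (suc i)   ≤⟨ +-mono-≤ (s-le-r (valid-s e) i i≤∣e∣) (peelCost-mono e 1+i≤x x≤∣e∣) ⟩
        r e i + peelCost e x         ≡⟨ cong (_+_ (r e i)) (sym (*-identityˡ _)) ⟩
        r e i + 1ℚ * peelCost e x    ∎
        where
        open ≤-Reasoning
        i = ∣ E e ∩ (T ∖ v) ∣
        x = ∣ E e ∩ X ∣
        ∣e∩T∣≡1+i : ∣ E e ∩ T ∣ ≡ suc i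
        ∣e∩T∣≡1+i = ∣p∩q∣≡1+∣p∩[q∖x]∣ {p = E e} {T} (lookup⇒[]= v (E e) v∈?e) v∈T
        1+i≤x : suc i ℕ.≤ x
        1+i≤x = subst (ℕ._≤ x) ∣e∩T∣≡1+i (p⊆q⇒∣p∣≤∣q∣ (∩-monoʳ-⊆ (E e) T⊆X))
        x≤∣e∣ : x ℕ.≤ ∣ E e ∣
        x≤∣e∣ = ∣p∩q∣≤∣p∣ (E e) X
        i≤∣e∣ : i ℕ.≤ ∣ E e ∣
        i≤∣e∣ = ℕ.≤-trans (ℕ.n≤1+n i) (ℕ.≤-trans 1+i≤x x≤∣e∣)
      ... | false = ≤-reflexive (begin
        r e ∣ E e ∩ T ∣    ≡⟨ cong (r e) (sym (x∉p⇒∣p∩[q∖x]∣≡∣p∩q∣ {p = E e} {T} (lookup≡false⇒∉ v∈?e))) ⟩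
        r e i              ≡⟨ sym (+-identityʳ (r e i)) ⟩
        r e i + 0ℚ         ≡⟨ cong (_+_ (r e i)) (sym (*-zeroˡ (peelCost e x))) ⟩
        r e i + 0ℚ * peelCost e x ∎)
        where
        open ≡-Reasoning
        i = ∣ E e ∩ (T ∖ v) ∣
        x = ∣ E e ∩ X ∣

      f≤f[T∖v]+weight : ∀ {T X v} → T ⊆ X → v ∈ T → f T ≤ f (T ∖ v) + weight X v
      f≤f[T∖v]+weight {T} {X} {v} T⊆X v∈T = begin
        f T                                         ≡⟨ f≡sum T ⟩
        ∑[ e < m ] r e ∣ E e ∩ T ∣                  ≤⟨ sum-mono-≤ (r[e∩T]≤r[e∩T∖v]+cost T⊆X v∈T) ⟩
        ∑[ e < m ] (r e ∣ E e ∩ (T ∖ v) ∣ + cost e) ≡⟨ ∑-distrib-+ _ cost ⟩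
        ∑[ e < m ] r e ∣ E e ∩ (T ∖ v) ∣ + ∑[ e < m ] cost e
                                                    ≡⟨ cong₂ _+_ (sym (f≡sum (T ∖ v))) (sym (weight≡sum X v)) ⟩
        f (T ∖ v) + weight X v                      ∎
        where
        open ≤-Reasoning
        cost : Fin m → ℚ
        cost e = 𝟙 (lookup (E e) v) * peelCost e ∣ E e ∩ X ∣

      Γ≤weight : ∀ {T X v} → RemovalStable T → T ⊆ X → v ∈ T → Γ T ≤ weight X v
      Γ≤weight {T} {X} {v} stable T⊆X v∈T = begin
        Γ T                          ≡⟨ solve 2 (λ g d → g := (con 1ℚ :+ d) :* g :- d :* g)
                                                refl (Γ T) (fromℕ d) ⟩
        (1ℚ + fromℕ d) * Γ T - d*Γ   ≡⟨ cong (_- d*Γ) (sym fT≡) ⟩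
        f T - d*Γ                    ≤⟨ +-monoˡ-≤ (- d*Γ) (f≤f[T∖v]+weight T⊆X v∈T) ⟩
        f (T ∖ v) + weight X v - d*Γ ≤⟨ +-monoˡ-≤ (- d*Γ) (+-monoˡ-≤ (weight X v) (stable v v∈T)) ⟩
        d*Γ + weight X v - d*Γ       ≡⟨ solve 2 (λ a w → a :+ w :- a := w) refl d*Γ (weight X v) ⟩
        weight X v                   ∎
        where
        open ≤-Reasoning
        d = ∣ T ∖ v ∣
        d*Γ = fromℕ d * Γ T
        fT≡ : f T ≡ (1ℚ + fromℕ d) * Γ T
        fT≡ = trans (f≡∣S∣*Γ (v , v∈T))
                    (cong (_* Γ T) (trans (cong fromℕ (∣p∣≡1+∣p∖x∣ v∈T)) (fromℕ-suc d)))

      ∑weight≤k*f : ∀ X → ∑[ u < n ] (𝟙 (lookup X u) * weight X u) ≤ fromℕ k * f X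
      ∑weight≤k*f X = begin
        ∑[ u < n ] (𝟙 (lookup X u) * weight X u)   ≡⟨ sum-cong-≗ expand ⟩
        ∑[ u < n ] ∑[ e < m ] term u e              ≡⟨ ∑-comm term ⟩
        ∑[ e < m ] ∑[ u < n ] term u e              ≡⟨ sum-cong-≗ (λ e → sum-cong-≗ (regroup e)) ⟩
        ∑[ e < m ] ∑[ u < n ] (𝟙 (lookup (E e ∩ X) u) * cost e)
                                                    ≡⟨ sum-cong-≗ (λ e → ∑𝟙*c≡∣p∣*c (E e ∩ X) (cost e)) ⟩
        ∑[ e < m ] (fromℕ ∣ E e ∩ X ∣ * cost e)     ≤⟨ sum-mono-≤ edge-bound ⟩
        ∑[ e < m ] (fromℕ k * r e ∣ E e ∩ X ∣)
                                                    ≡⟨ sym (*-distribˡ-sum (fromℕ k) (λ e → r e ∣ E e ∩ X ∣)) ⟩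
        fromℕ k * ∑[ e < m ] r e ∣ E e ∩ X ∣       ≡⟨ cong (_*_ (fromℕ k)) (sym (f≡sum X)) ⟩
        fromℕ k * f X                               ∎
        where
        open ≤-Reasoning
        cost : Fin m → ℚ
        cost e = peelCost e ∣ E e ∩ X ∣
        term : Fin n → Fin m → ℚ
        term u e = 𝟙 (lookup X u) * (𝟙 (lookup (E e) u) * cost e)
        expand : ∀ u → 𝟙 (lookup X u) * weight X u ≡ ∑[ e < m ] term u e
        expand u = trans (cong (_*_ (𝟙 (lookup X u))) (weight≡sum X u))
                         (*-distribˡ-sum (𝟙 (lookup X u)) (λ e → 𝟙 (lookup (E e) u) * cost e))
        regroup : ∀ e u → term u e ≡ 𝟙 (lookup (E e ∩ X) u) * cost e
        regroup e u = trans (solve 3 (λ a b c → a :* (b :* c) := b :* a :* c) refl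
                                     (𝟙 (lookup X u)) (𝟙 (lookup (E e) u)) (cost e))
                            (cong (_* cost e) (sym (𝟙-∩ (E e) X u)))
        edge-bound : ∀ e → fromℕ ∣ E e ∩ X ∣ * cost e ≤ fromℕ k * r e ∣ E e ∩ X ∣
        edge-bound e = begin
          fromℕ i * cost e   ≤⟨ *-monoˡ-≤-nonNeg (fromℕ i) {{fromℕ-nonNeg i}} cost≤r ⟩
          fromℕ i * r e i    ≤⟨ *-monoʳ-≤-nonNeg (r e i) {{nonNegative (r-nonneg (valid-r e) i i≤∣e∣)}}
                                  (fromℕ-mono-≤ (ℕ.≤-trans i≤∣e∣ (maxℕ-upper (λ e → ∣ E e ∣) e))) ⟩
          fromℕ k * r e i    ∎
          where
          i = ∣ E e ∩ X ∣
          i≤∣e∣ = ∣p∩q∣≤∣p∣ (E e) X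
          cost≤r : cost e ≤ r e i
          cost≤r = p-q≤p (s-nonneg (valid-s e) (i ∸ 1) (ℕ.≤-trans (ℕ.m∸n≤m i 1) i≤∣e∣))

      Γ≤k*Γ-at-removal : ∀ {T X v} → RemovalStable T → T ⊆ X → IsArgmin X v → v ∈ T → Γ T ≤ fromℕ k * Γ X
      Γ≤k*Γ-at-removal {T} {X} {v} stable T⊆X (v∈X , v-min) v∈T =
        fromℕ-cancelˡ-≤ ∣ X ∣ (ℕ.≤-trans (s≤s z≤n) (x∈p⇒∣p-x∣<∣p∣ v∈X)) (begin
          fromℕ ∣ X ∣ * Γ T                         ≡⟨ sym (∑𝟙*c≡∣p∣*c X (Γ T)) ⟩
          ∑[ u < n ] (𝟙 (lookup X u) * Γ T)         ≤⟨ sum-mono-≤ (λ u → 𝟙-*-mono-≤ (ΓT≤weight u)) ⟩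
          ∑[ u < n ] (𝟙 (lookup X u) * weight X u)  ≤⟨ ∑weight≤k*f X ⟩
          fromℕ k * f X                             ≡⟨ cong (_*_ (fromℕ k)) (f≡∣S∣*Γ (v , v∈X)) ⟩
          fromℕ k * (fromℕ ∣ X ∣ * Γ X)             ≡⟨ solve 3 (λ a b c → a :* (b :* c) := b :* (a :* c))
                                                               refl (fromℕ k) (fromℕ ∣ X ∣) (Γ X) ⟩
          fromℕ ∣ X ∣ * (fromℕ k * Γ X)             ∎)
        where
        open ≤-Reasoning
        ΓT≤weight : ∀ u → u ∈ X → Γ T ≤ weight X u
        ΓT≤weight u u∈X = ≤-trans (Γ≤weight stable T⊆X v∈T) (v-min u u∈X)

      Γ≤k*output-step : ∀ {X Y Out T v} → Run X Y Out → (Nonempty X → Γ X ≤ Γ Y) →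
        RemovalStable T → T ⊆ X → IsArgmin X v →
        (T ⊆ X ∖ v → Γ T ≤ fromℕ k * Γ Out) → Γ T ≤ fromℕ k * Γ Out
      Γ≤k*output-step {X} {Y} {Out} {T} {v} run ΓX≤ΓY stable T⊆X v-min@(v∈X , _) survives =
        case v ∈? T of λ where
          (yes v∈T) → ≤-trans (Γ≤k*Γ-at-removal stable T⊆X v-min v∈T)
                              (*-monoˡ-≤-nonNeg (fromℕ k) {{fromℕ-nonNeg k}} ΓX≤ΓOut)
          (no  v∉T) → survives (⊆-∖ T⊆X v∉T)
        where
        ΓX≤ΓOut : Γ X ≤ Γ Out
        ΓX≤ΓOut = ≤-trans (ΓX≤ΓY (v , v∈X)) (Run⇒Γ≤output run)

      Γ≤k*output : ∀ {X Y Out T} → Run X Y Out → (Nonempty X → Γ X ≤ Γ Y) →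
        RemovalStable T → Nonempty T → T ⊆ X → Γ T ≤ fromℕ k * Γ Out
      Γ≤k*output (done X=∅) _ _ (u , u∈T) T⊆X = ⊥-elim (X=∅ (u , T⊆X u∈T))
      Γ≤k*output run@(update _ v-min _ _ rest) ΓX≤ΓY stable T≠∅ T⊆X =
        Γ≤k*output-step run ΓX≤ΓY stable T⊆X v-min (Γ≤k*output rest (λ _ → ≤-refl) stable T≠∅)
      Γ≤k*output run@(keep _ v-min kept rest) ΓX≤ΓY stable T≠∅ T⊆X =
        Γ≤k*output-step run ΓX≤ΓY stable T⊆X v-min (Γ≤k*output rest (kept-Γ≤ kept) stable T≠∅)

theorem4 : (n m : ℕ) (E : Fin m → Subset n) (r s : Fin m → ℕ → ℚ) →
    (∀ e → Hypergraph.ValidReward E r e) →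
    (∀ e → Hypergraph.ValidS E r s e) →
    (Y : Subset n) → Hypergraph.Peeling.Run E r s ⊤ ⊤ Y →
    (S : Subset n) → Nonempty S →
    Hypergraph.Γ E r S ≤ ((+ Hypergraph.maxEdgeSize E r) / 1) * Hypergraph.Γ E r Y
theorem4 n m E r s valid-r valid-s Y run S S≠∅ =
  let T , T≠∅ , T-stable , ΓS≤ΓT = denser-removalStable E r r-zero S S≠∅
  in  ≤-trans ΓS≤ΓT (Γ≤k*output E r s valid-r valid-s run (λ _ → ≤-refl) T-stable T≠∅ ⊆⊤)
  where
  r-zero : ∀ e → r e 0 ≡ 0ℚ
  r-zero = Hypergraph.ValidReward.r-zero ∘ valid-r
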